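{- Let $k\ge 1$ be an integer and let $a_1\ge 1$ and $a_2,\dots,a_n\ge 2$ be integers. Then the number of integer points in $kP_{S(a_1,\ldots,a_n)}$ equals $$u^T \big(A(k,a_1)R\,A(k,a_2)R\cdots A(k,a_n)R\big) u,$$ where $u=(1,1,\ldots,1)^T$ has $k+1$ entries, $R$ is the $(k+1)\times(k+1)$ permutation matrix reversing the order of the coordinates of a vector, and $A(k,a)$ is the $(k+1)\times(k+1)$ matrix with rows and columns indexed by $\{0,\dots,k\}$ and entries $A_{ij}=\binom{a-2+j-i}{j-i}$.
   Context: For lattice paths $U,L$ from $(0,0)$ to $(m,r)$ using unit steps $(1,0),(0,1)$ with $L$ never above $U$, the lattice path matroid $M[U,L]$ is the matroid on $\{1,\dots,r+m\}$ whose bases are the sets of indices of the $(0,1)$-steps of lattice paths from $(0,0)$ to $(m,r)$ never above $U$ and never below $L$. A snake is a connected lattice path matroid with at least two elements whose diagram (region between $U$ and $L$) has no interior lattice points. The snake $S(a_1,\dots,a_n)$ is the one whose diagram, starting from the origin, consists of a horizontal row of $a_1$ unit squares to the right, then a vertical column of $a_2$ unit squares upward, then a horizontal row of $a_3$ squares to the right, and so on up to $a_n$, where the last square counted by each $a_i$ coincides with the first square counted by $a_{i+1}$. $P_M=\mathrm{conv}\{\sum_{i\in B}e_i: B\text{ a basis}\}$ and $kP_M=\{kx:x\in P_M\}$. Binomial conventions: $\binom{n}{s}=0$ for $s<0$, $\binom{n}{0}=1$, $\binom{n}{s}=n(n-1)\cdots(n-s+1)/s!$ for $s>0$. -}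

module Defs where

open import Data.Nat as ℕ using (ℕ; zero; suc; _!)
open import Data.Nat.Properties using (_!≢0)
open import Data.Integer as ℤ using (ℤ; +_; -[1+_])
open import Data.Rational as ℚ using (ℚ; 0ℚ; 1ℚ)
open import Data.Bool using (Bool; true; false; if_then_else_)
open import Data.List as List using (List; []; _∷_; _++_; replicate; take)
open import Data.Vec as Vec using (Vec)
open import Data.Fin as Fin using (Fin; toℕ; opposite)
open import Data.Fin.Properties using (_≟_)
open import Data.Product using (Σ; ∃; _×_)
open import Data.List.Relation.Unary.Any using (Any)
open import Relation.Binary.PropositionalEquality using (_≡_)
open import Relation.Nullary using (does)

falling : ℤ → ℕ → ℤ
falling n zero    = + 1
falling n (suc s) = falling n s ℤ.* (n ℤ.- + s)

binom : ℤ → ℤ → ℚ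
binom n -[1+ _ ]   = 0ℚ
binom n (+ zero)   = 1ℚ
binom n (+ suc s)  = (falling n (suc s) ℚ./ (suc s !)) {{(suc s) !≢0}}

-- Square matrices indexed by {0,…,k} = Fin (suc k), entries in ℚ

Mat : ℕ → Set
Mat k = Fin (suc k) → Fin (suc k) → ℚ

sumℚ : ∀ {n} → (Fin n → ℚ) → ℚ
sumℚ {zero}  f = 0ℚ
sumℚ {suc n} f = f Fin.zero ℚ.+ sumℚ (λ i → f (Fin.suc i))

_⊗_ : ∀ {k} → Mat k → Mat k → Mat k
(M ⊗ N) i j = sumℚ (λ l → M i l ℚ.* N l j)

idMat : ∀ k → Mat k
idMat k i j = if does (i ≟ j) then 1ℚ else 0ℚ

revMat : ∀ k → Mat k
revMat k i j = if does (j ≟ opposite i) then 1ℚ else 0ℚ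

AMat : ∀ k → ℕ → Mat k
AMat k a i j = binom ((+ a ℤ.- + 2) ℤ.+ (+ toℕ j ℤ.- + toℕ i)) (+ toℕ j ℤ.- + toℕ i)

prodAR : ∀ k → List ℕ → Mat k
prodAR k []       = idMat k
prodAR k (a ∷ as) = (AMat k a ⊗ revMat k) ⊗ prodAR k as

uMu : ∀ {k} → Mat k → ℚ
uMu M = sumℚ (λ i → sumℚ (λ j → M i j))

-- Lattice paths: a path is a list of steps, true = (0,1)-step (North),
-- false = (1,0)-step (East).

countN : List Bool → ℕ
countN []           = 0
countN (true ∷ bs)  = suc (countN bs)
countN (false ∷ bs) = countN bs

Between : List Bool → List Bool → List Bool → Set
Between U L P = ∀ t → countN (take t L) ℕ.≤ countN (take t P)
                    × countN (take t P) ℕ.≤ countN (take t U)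

-- The diagram of S(a₁,…,aₙ) is a chain of unit squares starting
-- with the square [0,1]²; successive squares move right (a₁-1 times),
-- then up (a₂-1 times), then right (a₃-1 times), etc.
-- dir = false : current move direction is right (East); true : up.

snakeMoves : Bool → List ℕ → List Bool
snakeMoves d []       = []
snakeMoves d (a ∷ as) = replicate (a ℕ.∸ 1) d ++ snakeMoves (if d then false else true) as

snakeU : List ℕ → List Bool
snakeU as = true ∷ snakeMoves false as ++ (false ∷ [])

snakeL : List ℕ → List Bool
snakeL as = false ∷ snakeMoves false as ++ (true ∷ [])

-- Lattice path matroid M[U,L] on ground set Fin (length U)
-- (element i ↔ step i+1).  A basis is given by (the indicator vector of)
-- a lattice path from (0,0) to (m,r) between L and U: its true-entries
-- are the indices of the North steps.

IsBasisPath : (U L : List Bool) → Vec Bool (List.length U) → Set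
IsBasisPath U L P = (countN (Vec.toList P) ≡ countN U) × Between U L (Vec.toList P)

indic : Bool → ℚ
indic true  = 1ℚ
indic false = 0ℚ

InDilatedPolytope : (U L : List Bool) → ℕ → (Vec ℚ (List.length U)) → Set
InDilatedPolytope U L k x =
  Σ ℕ λ N → Σ (Fin N → Vec Bool (List.length U)) λ B → Σ (Fin N → ℚ) λ λs →
    (∀ j → IsBasisPath U L (B j))
    × (∀ j → 0ℚ ℚ.≤ λs j)
    × (sumℚ λs ≡ 1ℚ)
    × (∀ i → Vec.lookup x i ≡ (+ k ℚ./ 1) ℚ.* sumℚ (λ j → λs j ℚ.* indic (Vec.lookup (B j) i)))

IntPoint : (U L : List Bool) → ℕ → Vec ℤ (List.length U) → Set
IntPoint U L k z = InDilatedPolytope U L k (Vec.map (λ n → n ℚ./ 1) z)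

-- Let mv be the word of inner steps of the snake S(a₁,…,aₙ) (false = East,
-- true = North), so that its boundary paths are U = N·mv·E and L = E·mv·N.
-- A "chain" is a sequence of heights h₀,…,h_m ∈ {0,…,k}, m = |mv|, with
-- hᵢ ≤ hᵢ₊₁ when the (i+1)-st step of mv is East and hᵢ ≥ hᵢ₊₁ when it is
-- North.  The proof establishes a bijection between chains and integer points
-- of k·P_{M[U,L]}, and counts chains with the matrices of the theorem.
--
-- Chains satisfy a transfer recursion; by Pascal's rule and the
--    hockey-stick identity, A(k,a) transfers across a run of a-1 East steps,
--    and R reflects heights h ↦ k-h, exchanging East and North.  Hence the
--    number of chains is uᵀ A(k,a₁)R⋯A(k,aₙ)R u.
--  * Chains give points.  The point of a chain records the height increments
--    (k extra on North steps); it is the sum of the k threshold paths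
--    (level j < k), each a basis, so it lies in k·P with weights 1/k.
--  * Points give chains.  Any point of k·P has coordinates in [0,k] and
--    prefix sums between k·#North of the prefixes of L and U; the heights are
--    recovered from these prefix sums.
module Submission where

open import Data.Nat as ℕ using (ℕ; zero; suc; _!; z≤n; s≤s)
import Data.Nat.Properties as ℕP
open import Data.Integer as ℤ using (ℤ; +_; -[1+_])
import Data.Integer.Properties as ℤP
import Data.Integer.Solver as ℤSolver
open import Data.Rational as ℚ using (ℚ; mkℚ; 0ℚ; 1ℚ; _/_; _+_; _*_; _-_; -_; _≤_)
import Data.Rational.Properties as ℚP
open import Data.Rational.Solver using (module +-*-Solver)
import Data.Nat.Coprimality as Coprime
open import Data.Fin as Fin using (Fin; toℕ; opposite; fromℕ<)
import Data.Fin.Properties as FinP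
import Data.Fin.Permutation as Perm
open import Data.Bool using (Bool; true; false; if_then_else_; T; not; _∧_; _∨_)
open import Data.Unit using (⊤; tt)
open import Data.Empty using (⊥; ⊥-elim)
open import Data.Product using (Σ; _×_; _,_; proj₁; proj₂)
open import Data.List as List using (List; []; _∷_; _++_; map; concatMap; length; replicate; take; allFin)
import Data.List.Properties as ListP
open import Data.List.Relation.Unary.All as All using (All)
open import Data.List.Relation.Unary.AllPairs using ([]; _∷_)
open import Data.List.Relation.Unary.Unique.Propositional using (Unique)
import Data.List.Relation.Unary.Unique.Propositional.Properties as Unique
open import Data.List.Membership.Propositional using (_∈_; find; lose)
open import Data.List.Membership.Propositional.Properties
open import Data.List.Relation.Unary.Any using (here)
open import Data.Vec as Vec using (Vec; []; _∷_; toList; lookup)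
import Data.Vec.Properties as VecP
open import Algebra.Bundles using (CommutativeRing)
import Algebra.Properties.Semiring.Sum
open import Function.Bundles using (_⇔_; mk⇔)
open import Relation.Nullary using (does)
open import Relation.Binary.PropositionalEquality
open import Defs

fromℤ : ℤ → ℚ
fromℤ a = a / 1

fromℤ≡mkℚ : ∀ a → fromℤ a ≡ mkℚ a 0 (Coprime.sym (Coprime.1-coprimeTo ℤ.∣ a ∣))
fromℤ≡mkℚ a = ℚP.↥p/↧p≡p (mkℚ a 0 (Coprime.sym (Coprime.1-coprimeTo ℤ.∣ a ∣)))

fromℤ-+ : ∀ a b → fromℤ (a ℤ.+ b) ≡ fromℤ a + fromℤ b
fromℤ-+ a b rewrite fromℤ≡mkℚ a | fromℤ≡mkℚ b =
  ℚP./-cong {p₁ = a ℤ.+ b} {q₁ = 1} (cong₂ ℤ._+_ (sym (ℤP.*-identityʳ a)) (sym (ℤP.*-identityʳ b))) refl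

fromℤ-* : ∀ a b → fromℤ (a ℤ.* b) ≡ fromℤ a * fromℤ b
fromℤ-* a b rewrite fromℤ≡mkℚ a | fromℤ≡mkℚ b = refl

fromℤ-neg : ∀ a → fromℤ (ℤ.- a) ≡ - fromℤ a
fromℤ-neg a = begin
  fromℤ (ℤ.- a)                          ≡⟨ solve 2 (λ x y → y := (x :+ y) :- x) refl (fromℤ a) (fromℤ (ℤ.- a)) ⟩
  (fromℤ a + fromℤ (ℤ.- a)) - fromℤ a    ≡⟨ cong (_- fromℤ a) (fromℤ-+ a (ℤ.- a)) ⟨
  fromℤ (a ℤ.+ ℤ.- a) - fromℤ a          ≡⟨ cong (λ x → fromℤ x - fromℤ a) (ℤP.+-inverseʳ a) ⟩
  0ℚ - fromℤ a                           ≡⟨ ℚP.+-identityˡ (- fromℤ a) ⟩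
  - fromℤ a                              ∎
  where open ≡-Reasoning; open +-*-Solver

fromℤ-- : ∀ a b → fromℤ (a ℤ.- b) ≡ fromℤ a - fromℤ b
fromℤ-- a b = trans (fromℤ-+ a (ℤ.- b)) (cong (_+_ (fromℤ a)) (fromℤ-neg b))

fromℤ-mono-≤ : ∀ {a b} → a ℤ.≤ b → fromℤ a ≤ fromℤ b
fromℤ-mono-≤ {a} {b} a≤b rewrite fromℤ≡mkℚ a | fromℤ≡mkℚ b =
  ℚ.*≤* (subst₂ ℤ._≤_ (sym (ℤP.*-identityʳ a)) (sym (ℤP.*-identityʳ b)) a≤b)

fromℤ-cancel-≤ : ∀ {a b} → fromℤ a ≤ fromℤ b → a ℤ.≤ b
fromℤ-cancel-≤ {a} {b} p rewrite fromℤ≡mkℚ a | fromℤ≡mkℚ b with p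
... | ℚ.*≤* q = subst₂ ℤ._≤_ (ℤP.*-identityʳ a) (ℤP.*-identityʳ b) q

#_ : ∀ {A : Set} → List A → ℚ
# xs = fromℤ (+ length xs)

#-++ : ∀ {A : Set} (xs ys : List A) → # (xs ++ ys) ≡ # xs + # ys
#-++ xs ys = trans (cong (λ n → fromℤ (+ n)) (ListP.length-++ xs)) (fromℤ-+ (+ length xs) (+ length ys))

#-map : ∀ {A B : Set} (f : A → B) xs → # map f xs ≡ # xs
#-map f xs = cong (λ n → fromℤ (+ n)) (ListP.length-map f xs)

-- Finite sums: Defs.sumℚ agrees with the library's semiring sum, from which
-- the reindexing laws are inherited.
module ∑ = Algebra.Properties.Semiring.Sum (CommutativeRing.semiring ℚP.+-*-commutativeRing)
open ∑ using (sum)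

sumℚ≡sum : ∀ {n} (f : Fin n → ℚ) → sumℚ f ≡ sum f
sumℚ≡sum {zero}  f = refl
sumℚ≡sum {suc n} f = cong (_+_ (f Fin.zero)) (sumℚ≡sum (λ i → f (Fin.suc i)))

sumℚ-cong : ∀ {n} {f g : Fin n → ℚ} → (∀ i → f i ≡ g i) → sumℚ f ≡ sumℚ g
sumℚ-cong {zero}  f≗g = refl
sumℚ-cong {suc n} f≗g = cong₂ _+_ (f≗g Fin.zero) (sumℚ-cong (λ i → f≗g (Fin.suc i)))

sumℚ-+ : ∀ {n} (f g : Fin n → ℚ) → sumℚ (λ i → f i + g i) ≡ sumℚ f + sumℚ g
sumℚ-+ f g = begin
  sumℚ (λ i → f i + g i)  ≡⟨ sumℚ≡sum (λ i → f i + g i) ⟩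
  sum (λ i → f i + g i)   ≡⟨ ∑.∑-distrib-+ f g ⟩
  sum f + sum g           ≡⟨ cong₂ _+_ (sumℚ≡sum f) (sumℚ≡sum g) ⟨
  sumℚ f + sumℚ g         ∎
  where open ≡-Reasoning

sumℚ-*ˡ : ∀ {n} c (f : Fin n → ℚ) → sumℚ (λ i → c * f i) ≡ c * sumℚ f
sumℚ-*ˡ c f = begin
  sumℚ (λ i → c * f i)  ≡⟨ sumℚ≡sum (λ i → c * f i) ⟩
  sum (λ i → c * f i)   ≡⟨ ∑.*-distribˡ-sum c f ⟨
  c * sum f             ≡⟨ cong (c *_) (sumℚ≡sum f) ⟨
  c * sumℚ f            ∎
  where open ≡-Reasoning

sumℚ-*ʳ : ∀ {n} c (f : Fin n → ℚ) → sumℚ (λ i → f i * c) ≡ sumℚ f * c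
sumℚ-*ʳ c f = trans (sumℚ-cong (λ i → ℚP.*-comm (f i) c)) (trans (sumℚ-*ˡ c f) (ℚP.*-comm c _))

sumℚ-neg : ∀ {n} (f : Fin n → ℚ) → sumℚ (λ i → - f i) ≡ - sumℚ f
sumℚ-neg {zero}  f = refl
sumℚ-neg {suc n} f = trans (cong (_+_ (- f Fin.zero)) (sumℚ-neg (λ i → f (Fin.suc i))))
                           (sym (ℚP.neg-distrib-+ (f Fin.zero) _))

sumℚ-- : ∀ {n} (f g : Fin n → ℚ) → sumℚ (λ i → f i - g i) ≡ sumℚ f - sumℚ g
sumℚ-- f g = trans (sumℚ-+ f (λ i → - g i)) (cong (_+_ (sumℚ f)) (sumℚ-neg g))

sumℚ-zero : ∀ {n} (f : Fin n → ℚ) → (∀ i → f i ≡ 0ℚ) → sumℚ f ≡ 0ℚ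
sumℚ-zero {n} f f≗0 = trans (sumℚ-cong f≗0) (trans (sumℚ≡sum {n} (λ _ → 0ℚ)) (∑.sum-replicate-zero n))

sumℚ-const : ∀ n c → sumℚ {n} (λ _ → c) ≡ fromℤ (+ n) * c
sumℚ-const zero    c = sym (ℚP.*-zeroˡ c)
sumℚ-const (suc n) c = begin
  c + sumℚ {n} (λ _ → c)       ≡⟨ cong (_+_ c) (sumℚ-const n c) ⟩
  c + fromℤ (+ n) * c          ≡⟨ solve 2 (λ c x → c :+ x :* c := (con 1ℚ :+ x) :* c) refl c (fromℤ (+ n)) ⟩
  (1ℚ + fromℤ (+ n)) * c       ≡⟨ cong (_* c) (fromℤ-+ (+ 1) (+ n)) ⟨
  fromℤ (+ suc n) * c          ∎
  where open ≡-Reasoning; open +-*-Solver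

sumℚ-swap : ∀ {m n} (f : Fin m → Fin n → ℚ) →
            sumℚ (λ i → sumℚ (f i)) ≡ sumℚ (λ j → sumℚ (λ i → f i j))
sumℚ-swap f = begin
  sumℚ (λ i → sumℚ (f i))              ≡⟨ double f ⟩
  sum (λ i → sum (f i))                ≡⟨ ∑.∑-comm f ⟩
  sum (λ j → sum (λ i → f i j))        ≡⟨ double (λ j i → f i j) ⟨
  sumℚ (λ j → sumℚ (λ i → f i j))      ∎
  where
  open ≡-Reasoning
  double : ∀ {m n} (g : Fin m → Fin n → ℚ) → sumℚ (λ i → sumℚ (g i)) ≡ sum (λ i → sum (g i))
  double g = trans (sumℚ-cong (λ i → sumℚ≡sum (g i))) (sumℚ≡sum (λ i → sum (g i)))

sumℚ-opposite : ∀ {n} (f : Fin n → ℚ) → sumℚ f ≡ sumℚ (λ i → f (opposite i))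
sumℚ-opposite {n} f = begin
  sumℚ f                        ≡⟨ sumℚ≡sum f ⟩
  sum f                         ≡⟨ ∑.sum-permute f (Perm.reverse {n}) ⟩
  sum (λ i → f (opposite i))    ≡⟨ sumℚ≡sum (λ i → f (opposite i)) ⟨
  sumℚ (λ i → f (opposite i))   ∎
  where open ≡-Reasoning

sumℚ-mono-≤ : ∀ {n} {f g : Fin n → ℚ} → (∀ i → f i ≤ g i) → sumℚ f ≤ sumℚ g
sumℚ-mono-≤ {zero}  f≤g = ℚP.≤-refl
sumℚ-mono-≤ {suc n} f≤g = ℚP.+-mono-≤ (f≤g Fin.zero) (sumℚ-mono-≤ (λ i → f≤g (Fin.suc i)))

δ : ∀ {n} → Fin n → Fin n → ℚ
δ i j = if does (i FinP.≟ j) then 1ℚ else 0ℚ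

δ-sym : ∀ {n} (i j : Fin n) → δ i j ≡ δ j i
δ-sym Fin.zero    Fin.zero    = refl
δ-sym Fin.zero    (Fin.suc j) = refl
δ-sym (Fin.suc i) Fin.zero    = refl
δ-sym (Fin.suc i) (Fin.suc j) = δ-sym i j

sumℚ-δ : ∀ {n} (i : Fin n) (f : Fin n → ℚ) → sumℚ (λ m → δ i m * f m) ≡ f i
sumℚ-δ Fin.zero f = begin
  1ℚ * f Fin.zero + sumℚ (λ m → 0ℚ * f (Fin.suc m))
    ≡⟨ cong₂ _+_ (ℚP.*-identityˡ (f Fin.zero)) (sumℚ-zero (λ m → 0ℚ * f (Fin.suc m)) (λ m → ℚP.*-zeroˡ (f (Fin.suc m)))) ⟩
  f Fin.zero + 0ℚ  ≡⟨ ℚP.+-identityʳ (f Fin.zero) ⟩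
  f Fin.zero       ∎
  where open ≡-Reasoning
sumℚ-δ (Fin.suc i) f = begin
  0ℚ * f Fin.zero + sumℚ (λ m → δ i m * f (Fin.suc m))
    ≡⟨ cong₂ _+_ (ℚP.*-zeroˡ (f Fin.zero)) (sumℚ-δ i (λ m → f (Fin.suc m))) ⟩
  0ℚ + f (Fin.suc i)  ≡⟨ ℚP.+-identityˡ (f (Fin.suc i)) ⟩
  f (Fin.suc i)       ∎
  where open ≡-Reasoning

recip : ℕ → ℚ
recip d = mkℚ (+ 1) d (Coprime.1-coprimeTo (suc d))

recip-inverse : ∀ d → recip d * fromℤ (+ suc d) ≡ 1ℚ
recip-inverse d rewrite fromℤ≡mkℚ (+ suc d) =
  ℚP.*-inverseˡ (mkℚ (+ suc d) 0 (Coprime.sym (Coprime.1-coprimeTo (suc d))))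

/≡*recip : ∀ x d → x / suc d ≡ fromℤ x * recip d
/≡*recip x d rewrite fromℤ≡mkℚ x = ℚP./-cong (sym (ℤP.*-identityʳ x)) (sym (ℕP.+-identityʳ (suc d)))

/-*-cancel : ∀ x n .{{_ : ℕ.NonZero n}} → (x / n) * fromℤ (+ n) ≡ fromℤ x
/-*-cancel x (suc d) = begin
  (x / suc d) * fromℤ (+ suc d)            ≡⟨ cong (_* fromℤ (+ suc d)) (/≡*recip x d) ⟩
  (fromℤ x * recip d) * fromℤ (+ suc d)    ≡⟨ ℚP.*-assoc (fromℤ x) (recip d) (fromℤ (+ suc d)) ⟩
  fromℤ x * (recip d * fromℤ (+ suc d))    ≡⟨ cong (fromℤ x *_) (recip-inverse d) ⟩
  fromℤ x * 1ℚ                             ≡⟨ ℚP.*-identityʳ (fromℤ x) ⟩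
  fromℤ x                                  ∎
  where open ≡-Reasoning

*-cancelʳ-pos : ∀ n .{{_ : ℕ.NonZero n}} {x y : ℚ} → x * fromℤ (+ n) ≡ y * fromℤ (+ n) → x ≡ y
*-cancelʳ-pos (suc d) {x} {y} eq = begin
  x                                    ≡⟨ scale x ⟩
  (x * fromℤ (+ suc d)) * recip d      ≡⟨ cong (_* recip d) eq ⟩
  (y * fromℤ (+ suc d)) * recip d      ≡⟨ scale y ⟨
  y                                    ∎
  where
  open ≡-Reasoning
  scale : ∀ z → z ≡ (z * fromℤ (+ suc d)) * recip d
  scale z = begin
    z                                   ≡⟨ ℚP.*-identityʳ z ⟨
    z * 1ℚ                              ≡⟨ cong (z *_) (trans (ℚP.*-comm (fromℤ (+ suc d)) (recip d)) (recip-inverse d)) ⟨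
    z * (fromℤ (+ suc d) * recip d)     ≡⟨ ℚP.*-assoc z (fromℤ (+ suc d)) (recip d) ⟨
    (z * fromℤ (+ suc d)) * recip d     ∎

binom-falling : ∀ n t → binom n (+ t) * fromℤ (+ (t !)) ≡ fromℤ (falling n t)
binom-falling n zero    = refl
binom-falling n (suc t) = /-*-cancel (falling n (suc t)) (suc t !) {{suc t ℕP.!≢0}}

falling-pascal : ∀ n t → falling n (suc t) ≡ falling (n ℤ.- + 1) (suc t) ℤ.+ + suc t ℤ.* falling (n ℤ.- + 1) t
falling-pascal n t = trans (peel n t) (solve 3 (λ n F y → n :* F := F :* ((n :- con (+ 1)) :- y) :+ (con (+ 1) :+ y) :* F)
                                               refl n (falling (n ℤ.- + 1) t) (+ t))
  where
  open ℤSolver.+-*-Solver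
  peel : ∀ n s → falling n (suc s) ≡ n ℤ.* falling (n ℤ.- + 1) s
  peel n zero    = solve 1 (λ n → con (+ 1) :* (n :- con (+ 0)) := n :* con (+ 1)) refl n
  peel n (suc s) = trans (cong (ℤ._* (n ℤ.- + suc s)) (peel n s))
    (solve 3 (λ n F y → n :* F :* (n :- (con (+ 1) :+ y)) := n :* (F :* ((n :- con (+ 1)) :- y))) refl
           n (falling (n ℤ.- + 1) s) (+ s))

pascal : ∀ n s → binom n s ≡ binom (n ℤ.- + 1) s + binom (n ℤ.- + 1) (s ℤ.- + 1)
pascal n -[1+ _ ]  = sym (ℚP.+-identityʳ 0ℚ)
pascal n (+ zero)  = sym (ℚP.+-identityʳ 1ℚ)
pascal n (+ suc t) = *-cancelʳ-pos (suc t !) {{suc t ℕP.!≢0}} (begin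
  binom n (+ suc t) * fromℤ (+ (suc t !))                          ≡⟨ binom-falling n (suc t) ⟩
  fromℤ (falling n (suc t))                                         ≡⟨ cong fromℤ (falling-pascal n t) ⟩
  fromℤ (falling n′ (suc t) ℤ.+ + suc t ℤ.* falling n′ t)
    ≡⟨ trans (fromℤ-+ (falling n′ (suc t)) (+ suc t ℤ.* falling n′ t)) (cong₂ _+_ (sym (binom-falling n′ (suc t))) (fromℤ-* (+ suc t) (falling n′ t))) ⟩
  Y * fromℤ (+ (suc t !)) + fromℤ (+ suc t) * fromℤ (falling n′ t)
    ≡⟨ cong (λ w → Y * fromℤ (+ (suc t !)) + fromℤ (+ suc t) * w) (binom-falling n′ t) ⟨
  Y * fromℤ (+ (suc t !)) + fromℤ (+ suc t) * (Z * fromℤ (+ (t !)))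
    ≡⟨ cong (λ w → Y * fromℤ (+ (suc t !)) + w) (reassoc (fromℤ (+ suc t)) Z (fromℤ (+ (t !)))) ⟩
  Y * fromℤ (+ (suc t !)) + Z * (fromℤ (+ suc t) * fromℤ (+ (t !)))
    ≡⟨ cong (λ w → Y * fromℤ (+ (suc t !)) + Z * w) (sym (trans (cong fromℤ (ℤP.pos-* (suc t) (t !))) (fromℤ-* (+ suc t) (+ (t !))))) ⟩
  Y * fromℤ (+ (suc t !)) + Z * fromℤ (+ (suc t !))                 ≡⟨ ℚP.*-distribʳ-+ (fromℤ (+ (suc t !))) Y Z ⟨
  (Y + Z) * fromℤ (+ (suc t !))                                     ∎)
  where
  open ≡-Reasoning
  n′ = n ℤ.- + 1
  Y = binom n′ (+ suc t)
  Z = binom n′ (+ t)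
  reassoc : ∀ a b c → a * (b * c) ≡ b * (a * c)
  reassoc = solve 3 (λ a b c → a :* (b :* c) := b :* (a :* c)) refl
    where open +-*-Solver

-- binom t (t+1) = 0 for natural t: the falling factorial passes through zero.
binom-vanishes : ∀ t → binom (+ t) (+ suc t) ≡ 0ℚ
binom-vanishes t rewrite ℤP.+-inverseʳ (+ t) | ℤP.*-zeroʳ (falling (+ t) t) =
  ℚP.0/n≡0 (suc t !) {{suc t ℕP.!≢0}}

aEntry : ℕ → ℕ → ℕ → ℚ
aEntry a x y = binom ((+ a ℤ.- + 2) ℤ.+ (+ y ℤ.- + x)) (+ y ℤ.- + x)

diff-suc : ∀ x y → + suc y ℤ.- + suc x ≡ + y ℤ.- + x
diff-suc x y = solve 2 (λ X Y → (con (+ 1) :+ Y) :- (con (+ 1) :+ X) := Y :- X) refl (+ x) (+ y)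
  where open ℤSolver.+-*-Solver

aEntry-suc : ∀ a x y → aEntry a (suc x) (suc y) ≡ aEntry a x y
aEntry-suc a x y rewrite diff-suc x y = refl

binom-below : ∀ y x → y ℕ.< x → ∀ n → binom n (+ y ℤ.- + x) ≡ 0ℚ
binom-below zero    (suc x) _         n = refl
binom-below (suc y) (suc x) (s≤s y<x) n rewrite diff-suc x y = binom-below y x y<x n

aEntry-one : ∀ {n} (i j : Fin n) → aEntry 1 (toℕ i) (toℕ j) ≡ δ i j
aEntry-one Fin.zero    Fin.zero    = refl
aEntry-one Fin.zero    (Fin.suc j) = binom-vanishes (toℕ j ℕ.+ 0)
aEntry-one (Fin.suc i) Fin.zero    = refl
aEntry-one (Fin.suc i) (Fin.suc j) = trans (aEntry-suc 1 (toℕ i) (toℕ j)) (aEntry-one i j)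

aEntry-pascal : ∀ a x y → aEntry (suc a) x y ≡ aEntry a x y + aEntry (suc a) (suc x) y
aEntry-pascal a x y =
  trans (pascal n s) (cong₂ _+_ (cong (λ m → binom m s) (upper (+ a) s))
                                (cong₂ binom (upper′ (+ a) (+ x) (+ y)) (lower (+ x) (+ y))))
  where
  open ℤSolver.+-*-Solver
  s = + y ℤ.- + x
  n = (+ suc a ℤ.- + 2) ℤ.+ s
  upper : ∀ A s → ((+ 1 ℤ.+ A) ℤ.- + 2) ℤ.+ s ℤ.- + 1 ≡ (A ℤ.- + 2) ℤ.+ s
  upper = solve 2 (λ A s → ((con (+ 1) :+ A) :- con (+ 2)) :+ s :- con (+ 1) := (A :- con (+ 2)) :+ s) refl
  upper′ : ∀ A X Y → ((+ 1 ℤ.+ A) ℤ.- + 2) ℤ.+ (Y ℤ.- X) ℤ.- + 1 ≡ ((+ 1 ℤ.+ A) ℤ.- + 2) ℤ.+ (Y ℤ.- (+ 1 ℤ.+ X))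
  upper′ = solve 3 (λ A X Y → ((con (+ 1) :+ A) :- con (+ 2)) :+ (Y :- X) :- con (+ 1)
                            := ((con (+ 1) :+ A) :- con (+ 2)) :+ (Y :- (con (+ 1) :+ X))) refl
  lower : ∀ X Y → (Y ℤ.- X) ℤ.- + 1 ≡ Y ℤ.- (+ 1 ℤ.+ X)
  lower = solve 2 (λ X Y → (Y :- X) :- con (+ 1) := Y :- (con (+ 1) :+ X)) refl

when : Bool → ℚ → ℚ
when b x = if b then x else 0ℚ

when-*ʳ : ∀ b x c → when b x * c ≡ when b (x * c)
when-*ʳ true  x c = refl
when-*ʳ false x c = ℚP.*-zeroˡ c

sumℚ-when : ∀ {n} b (g : Fin n → ℚ) → sumℚ (λ m → when b (g m)) ≡ when b (sumℚ g)
sumℚ-when true  g = refl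
sumℚ-when {n} false g = sumℚ-zero {n} (λ _ → 0ℚ) (λ _ → refl)

telescope : ∀ n (F : ℕ → ℚ) x → x ℕ.≤ n →
            sumℚ {n} (λ h → when (x ℕ.≤ᵇ toℕ h) (F (toℕ h) - F (suc (toℕ h)))) ≡ F x - F n
telescope zero    F zero    z≤n       = sym (ℚP.+-inverseʳ (F 0))
telescope (suc n) F zero    z≤n       = begin
  (F 0 - F 1) + sumℚ {n} (λ h → F (suc (toℕ h)) - F (suc (suc (toℕ h))))
    ≡⟨ cong (_+_ (F 0 - F 1)) (telescope n (λ h → F (suc h)) zero z≤n) ⟩
  (F 0 - F 1) + (F 1 - F (suc n))
    ≡⟨ solve 3 (λ a b c → (a :- b) :+ (b :- c) := a :- c) refl (F 0) (F 1) (F (suc n)) ⟩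
  F 0 - F (suc n) ∎
  where open ≡-Reasoning; open +-*-Solver
telescope (suc n) F (suc x) (s≤s x≤n) = begin
  0ℚ + sumℚ {n} (λ h → when (x ℕ.<ᵇ suc (toℕ h)) (G (toℕ h) - G (suc (toℕ h))))
    ≡⟨ ℚP.+-identityˡ _ ⟩
  sumℚ {n} (λ h → when (x ℕ.<ᵇ suc (toℕ h)) (G (toℕ h) - G (suc (toℕ h))))
    ≡⟨ sumℚ-cong {n} (λ h → cong (λ b → when b (G (toℕ h) - G (suc (toℕ h)))) (<ᵇ-suc x (toℕ h))) ⟩
  sumℚ {n} (λ h → when (x ℕ.≤ᵇ toℕ h) (G (toℕ h) - G (suc (toℕ h))))
    ≡⟨ telescope n G x x≤n ⟩
  G x - G n ∎
  where
  open ≡-Reasoning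
  G = λ h → F (suc h)
  <ᵇ-suc : ∀ x h → (x ℕ.<ᵇ suc h) ≡ (x ℕ.≤ᵇ h)
  <ᵇ-suc zero    h = refl
  <ᵇ-suc (suc x) h = refl

-- Hockey-stick identity: A(b+2)_{xy} = Σ_{x ≤ h ≤ k} A(b+1)_{hy}, for x, y ≤ k.
-- This is what lets one factor A(b+2) absorb one more weakly increasing step.
aEntry-hockey : ∀ b k x y → x ℕ.≤ k → y ℕ.≤ k →
  aEntry (suc (suc b)) x y ≡ sumℚ {suc k} (λ h → when (x ℕ.≤ᵇ toℕ h) (aEntry (suc b) (toℕ h) y))
aEntry-hockey b k x y x≤k y≤k = sym (begin
  sumℚ {suc k} (λ h → when (x ℕ.≤ᵇ toℕ h) (aEntry (suc b) (toℕ h) y))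
    ≡⟨ sumℚ-cong {suc k} (λ h → cong (when (x ℕ.≤ᵇ toℕ h)) (difference (toℕ h))) ⟩
  sumℚ {suc k} (λ h → when (x ℕ.≤ᵇ toℕ h) (F (toℕ h) - F (suc (toℕ h))))
    ≡⟨ telescope (suc k) F x (ℕP.m≤n⇒m≤1+n x≤k) ⟩
  F x - F (suc k)  ≡⟨ cong (_-_ (F x)) (binom-below y (suc k) (s≤s y≤k) _) ⟩
  F x - 0ℚ         ≡⟨ ℚP.+-identityʳ (F x) ⟩
  F x              ∎)
  where
  open ≡-Reasoning
  F = λ h → aEntry (suc (suc b)) h y
  difference : ∀ h → aEntry (suc b) h y ≡ F h - F (suc h)
  difference h = trans (solve 2 (λ g f′ → g := (g :+ f′) :- f′) refl (aEntry (suc b) h y) (F (suc h)))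
                       (cong (_- F (suc h)) (sym (aEntry-pascal (suc b) h y)))
    where open +-*-Solver

#-concatMap-tabulate : ∀ {A B : Set} n (f : B → List A) (g : Fin n → B) →
  # concatMap f (List.tabulate g) ≡ sumℚ (λ i → # f (g i))
#-concatMap-tabulate zero    f g = refl
#-concatMap-tabulate (suc n) f g =
  trans (#-++ (f (g Fin.zero)) _) (cong (_+_ (# f (g Fin.zero))) (#-concatMap-tabulate n f (λ i → g (Fin.suc i))))

concatMap-unique : ∀ {A B : Set} (tag : B → A) (f : A → List B) {xs : List A} → Unique xs →
  (∀ x → Unique (f x)) → (∀ x {v} → v ∈ f x → tag v ≡ x) → Unique (concatMap f xs)
concatMap-unique tag f {[]}     _              _      _      = []
concatMap-unique tag f {x ∷ xs} (x∉xs ∷ uniq) f-uniq tagged =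
  Unique.++⁺ (f-uniq x) (concatMap-unique tag f uniq f-uniq tagged) disjoint
  where
  disjoint : ∀ {v} → v ∈ f x × v ∈ concatMap f xs → ⊥
  disjoint (v∈fx , v∈rest) with find (∈-concatMap⁻ f {xs = xs} v∈rest)
  ... | y , y∈xs , v∈fy = All.lookup x∉xs y∈xs (trans (sym (tagged x v∈fx)) (tagged y v∈fy))

module Chains {D : Set} (n : ℕ) (related : D → Fin n → Fin n → Bool) where

  IsChain : Fin n → (w : List D) → Vec (Fin n) (length w) → Set
  IsChain p []      []       = ⊤
  IsChain p (d ∷ w) (h ∷ hs) = T (related d p h) × IsChain h w hs

  extend : ∀ {m} → Fin n → Bool → List (Vec (Fin n) m) → List (Vec (Fin n) (suc m))
  extend h true  vs = map (h ∷_) vs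
  extend h false vs = []

  chains : Fin n → (w : List D) → List (Vec (Fin n) (length w))
  chains p []      = [] ∷ []
  chains p (d ∷ w) = concatMap (λ h → extend h (related d p h) (chains h w)) (allFin n)

  chains-sound : ∀ p w hs → hs ∈ chains p w → IsChain p w hs
  chains-sound p []      []       _    = tt
  chains-sound p (d ∷ w) hs       hs∈ with find (∈-concatMap⁻ _ {xs = allFin n} hs∈)
  ... | h , _ , hs∈ext with related d p h in rel
  ... | true with ∈-map⁻ (h ∷_) hs∈ext
  ...   | hs′ , hs′∈ , refl = subst T (sym rel) tt , chains-sound h w hs′ hs′∈
  chains-sound p (d ∷ w) hs _ | h , _ , () | false

  chains-complete : ∀ p w hs → IsChain p w hs → hs ∈ chains p w
  chains-complete p []      []       _           = here refl
  chains-complete p (d ∷ w) (h ∷ hs) (rel , chn) =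
    ∈-concatMap⁺ _ {xs = allFin n} (lose (∈-allFin h) (in-extend (related d p h) rel))
    where
    in-extend : ∀ b → T b → (h ∷ hs) ∈ extend h b (chains h w)
    in-extend true _ = ∈-map⁺ (h ∷_) (chains-complete h w hs chn)

  chains-unique : ∀ p w → Unique (chains p w)
  chains-unique p []      = All.[] ∷ []
  chains-unique p (d ∷ w) =
    concatMap-unique Vec.head _ (Unique.allFin⁺ n)
      (λ h → extend-unique (related d p h) (chains-unique h w)) (λ h → extend-head (related d p h))
    where
    extend-unique : ∀ {m h} b {vs : List (Vec (Fin n) m)} → Unique vs → Unique (extend h b vs)
    extend-unique true  uniq = Unique.map⁺ VecP.∷-injectiveʳ uniq
    extend-unique false uniq = []
    extend-head : ∀ {m h} b {vs : List (Vec (Fin n) m)} {v} → v ∈ extend h b vs → Vec.head v ≡ h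
    extend-head true v∈ with ∈-map⁻ _ v∈
    ... | _ , _ , refl = refl

  #chains-∷ : ∀ d w p → # chains p (d ∷ w) ≡ sumℚ (λ h → when (related d p h) (# chains h w))
  #chains-∷ d w p = trans (#-concatMap-tabulate n (λ h → extend h (related d p h) (chains h w)) (λ i → i))
                          (sumℚ-cong (λ h → #extend (related d p h)))
    where
    #extend : ∀ {h} b → # extend h b (chains h w) ≡ when b (# chains h w)
    #extend true  = #-map _ (chains _ w)
    #extend false = refl

T-ext : ∀ {a b} → (T a → T b) → (T b → T a) → a ≡ b
T-ext {false} {false} _ _ = refl
T-ext {false} {true}  _ g = ⊥-elim (g tt)
T-ext {true}  {false} f _ = ⊥-elim (f tt)
T-ext {true}  {true}  _ _ = refl

apply : ∀ {k} → Mat k → (Fin (suc k) → ℚ) → Fin (suc k) → ℚ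
apply M v i = sumℚ (λ l → M i l * v l)

apply-⊗ : ∀ {k} (M N : Mat k) v i → apply (M ⊗ N) v i ≡ apply M (apply N v) i
apply-⊗ M N v i = begin
  sumℚ (λ l → sumℚ (λ m → M i m * N m l) * v l)    ≡⟨ sumℚ-cong (λ l → sym (sumℚ-*ʳ (v l) (λ m → M i m * N m l))) ⟩
  sumℚ (λ l → sumℚ (λ m → M i m * N m l * v l))    ≡⟨ sumℚ-swap (λ l m → M i m * N m l * v l) ⟩
  sumℚ (λ m → sumℚ (λ l → M i m * N m l * v l))    ≡⟨ sumℚ-cong (λ m → trans (sumℚ-cong (λ l → ℚP.*-assoc (M i m) (N m l) (v l)))
                                                                             (sumℚ-*ˡ (M i m) (λ l → N m l * v l))) ⟩
  sumℚ (λ m → M i m * sumℚ (λ l → N m l * v l))    ∎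
  where open ≡-Reasoning

rowSum-⊗ : ∀ {k} (M N : Mat k) i → sumℚ ((M ⊗ N) i) ≡ apply M (λ l → sumℚ (N l)) i
rowSum-⊗ M N i = begin
  sumℚ (λ j → sumℚ (λ l → M i l * N l j))    ≡⟨ sumℚ-swap (λ j l → M i l * N l j) ⟩
  sumℚ (λ l → sumℚ (λ j → M i l * N l j))    ≡⟨ sumℚ-cong (λ l → sumℚ-*ˡ (M i l) (N l)) ⟩
  sumℚ (λ l → M i l * sumℚ (N l))            ∎
  where open ≡-Reasoning

apply-revMat : ∀ k v (m : Fin (suc k)) → apply (revMat k) v m ≡ v (opposite m)
apply-revMat k v m = trans (sumℚ-cong (λ l → cong (_* v l) (δ-sym l (opposite m)))) (sumℚ-δ (opposite m) v)

rowSum-idMat : ∀ k (i : Fin (suc k)) → sumℚ (idMat k i) ≡ 1ℚ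
rowSum-idMat k i = trans (sumℚ-cong (λ j → sym (ℚP.*-identityʳ (δ i j)))) (sumℚ-δ i (λ _ → 1ℚ))

apply-when-sum : ∀ {k} (c : Fin (suc k) → Fin (suc k) → Bool) (G : Mat k) v i →
  apply (λ i m → sumℚ (λ h → when (c i h) (G h m))) v i ≡ sumℚ (λ h → when (c i h) (apply G v h))
apply-when-sum c G v i = begin
  sumℚ (λ m → sumℚ (λ h → when (c i h) (G h m)) * v m)   ≡⟨ sumℚ-cong (λ m → sym (sumℚ-*ʳ (v m) (λ h → when (c i h) (G h m)))) ⟩
  sumℚ (λ m → sumℚ (λ h → when (c i h) (G h m) * v m))   ≡⟨ sumℚ-swap (λ m h → when (c i h) (G h m) * v m) ⟩
  sumℚ (λ h → sumℚ (λ m → when (c i h) (G h m) * v m))   ≡⟨ sumℚ-cong (λ h → trans (sumℚ-cong (λ m → when-*ʳ (c i h) (G h m) (v m)))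
                                                                                  (sumℚ-when (c i h) (λ m → G h m * v m))) ⟩
  sumℚ (λ h → when (c i h) (sumℚ (λ m → G h m * v m)))   ∎
  where open ≡-Reasoning

map-not-run : ∀ d r {ws ws′} → ws ≡ map not ws′ → replicate r (not d) ++ ws ≡ map not (replicate r d ++ ws′)
map-not-run d r {ws′ = ws′} eq =
  sym (trans (ListP.map-++ not (replicate r d) ws′) (cong₂ _++_ (ListP.map-replicate not r d) (sym eq)))

snakeMoves-not : ∀ d as → snakeMoves (not d) as ≡ map not (snakeMoves d as)
snakeMoves-not d     []       = refl
snakeMoves-not false (a ∷ as) = map-not-run false (a ℕ.∸ 1) (snakeMoves-not true as)
snakeMoves-not true  (a ∷ as) = map-not-run true (a ℕ.∸ 1) (snakeMoves-not false as)

-- Counting them is the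
-- combinatorial heart of the theorem: the matrices A(k,a) and R are exactly the
-- transfer matrices of a run of a-1 East steps and of a change of direction.
module Heights (k : ℕ) where

  Height : Set
  Height = Fin (suc k)

  step : Bool → Height → Height → Bool
  step false p h = toℕ p ℕ.≤ᵇ toℕ h
  step true  p h = toℕ h ℕ.≤ᵇ toℕ p

  open Chains (suc k) step public

  count : List Bool → Height → ℚ
  count w p = # chains p w

  toℕ≤k : ∀ (h : Height) → toℕ h ℕ.≤ k
  toℕ≤k h = ℕP.≤-pred (FinP.toℕ<n h)

  opposite-antitone : ∀ (i j : Height) → toℕ i ℕ.≤ toℕ j → toℕ (opposite j) ℕ.≤ toℕ (opposite i)
  opposite-antitone i j i≤j rewrite FinP.opposite-prop i | FinP.opposite-prop j = ℕP.∸-monoʳ-≤ k i≤j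

  ≤ᵇ-opposite : ∀ (i j : Height) → (toℕ i ℕ.≤ᵇ toℕ j) ≡ (toℕ (opposite j) ℕ.≤ᵇ toℕ (opposite i))
  ≤ᵇ-opposite i j = T-ext (λ t → ℕP.≤⇒≤ᵇ (opposite-antitone i j (ℕP.≤ᵇ⇒≤ _ _ t)))
                          (λ t → ℕP.≤⇒≤ᵇ (subst₂ ℕ._≤_ (cong toℕ (FinP.opposite-involutive i))
                                                         (cong toℕ (FinP.opposite-involutive j))
                                    (opposite-antitone (opposite j) (opposite i) (ℕP.≤ᵇ⇒≤ _ _ t))))

  step-opposite : ∀ d (p h : Height) → step (not d) p h ≡ step d (opposite p) (opposite h)
  step-opposite false p h = ≤ᵇ-opposite h p
  step-opposite true  p h = ≤ᵇ-opposite p h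

  count-opposite : ∀ w p → count (map not w) p ≡ count w (opposite p)
  count-opposite []      p = refl
  count-opposite (d ∷ w) p = begin
    count (not d ∷ map not w) p
      ≡⟨ #chains-∷ (not d) (map not w) p ⟩
    sumℚ (λ h → when (step (not d) p h) (count (map not w) h))
      ≡⟨ sumℚ-cong (λ h → cong₂ when (step-opposite d p h) (count-opposite w h)) ⟩
    sumℚ (λ h → when (step d (opposite p) (opposite h)) (count w (opposite h)))
      ≡⟨ sumℚ-opposite (λ h → when (step d (opposite p) h) (count w h)) ⟨
    sumℚ (λ h → when (step d (opposite p) h) (count w h))
      ≡⟨ #chains-∷ d w (opposite p) ⟨
    count (d ∷ w) (opposite p) ∎
    where open ≡-Reasoning

  count-east : ∀ b w i → apply (AMat k (suc b)) (count w) i ≡ count (replicate b false ++ w) i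
  count-east zero    w i = trans (sumℚ-cong (λ m → cong (_* count w m) (aEntry-one i m))) (sumℚ-δ i (count w))
  count-east (suc b) w i = begin
    apply (AMat k (suc (suc b))) (count w) i
      ≡⟨ sumℚ-cong (λ m → cong (_* count w m) (aEntry-hockey b k (toℕ i) (toℕ m) (toℕ≤k i) (toℕ≤k m))) ⟩
    apply (λ i m → sumℚ (λ h → when (step false i h) (AMat k (suc b) h m))) (count w) i
      ≡⟨ apply-when-sum (step false) (AMat k (suc b)) (count w) i ⟩
    sumℚ (λ h → when (step false i h) (apply (AMat k (suc b)) (count w) h))
      ≡⟨ sumℚ-cong (λ h → cong (when (step false i h)) (count-east b w h)) ⟩
    sumℚ (λ h → when (step false i h) (count (replicate b false ++ w) h))
      ≡⟨ #chains-∷ false (replicate b false ++ w) i ⟨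
    count (replicate (suc b) false ++ w) i ∎
    where open ≡-Reasoning

  rowSum-prodAR : ∀ as → All (1 ℕ.≤_) as → ∀ i → sumℚ (prodAR k as i) ≡ count (snakeMoves false as) i
  rowSum-prodAR []             All.[]         i = rowSum-idMat k i
  rowSum-prodAR (suc b ∷ as) (_ All.∷ as≥1) i = begin
    sumℚ (((A ⊗ revMat k) ⊗ P) i)               ≡⟨ rowSum-⊗ (A ⊗ revMat k) P i ⟩
    apply (A ⊗ revMat k) (λ l → sumℚ (P l)) i   ≡⟨ apply-⊗ A (revMat k) (λ l → sumℚ (P l)) i ⟩
    apply A (apply (revMat k) (λ l → sumℚ (P l))) i
      ≡⟨ sumℚ-cong (λ m → cong (A i m *_) (trans (apply-revMat k (λ l → sumℚ (P l)) m) (reversed m))) ⟩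
    apply A (count (snakeMoves true as)) i      ≡⟨ count-east b (snakeMoves true as) i ⟩
    count (snakeMoves false (suc b ∷ as)) i     ∎
    where
    open ≡-Reasoning
    A = AMat k (suc b)
    P = prodAR k as
    reversed : ∀ m → sumℚ (P (opposite m)) ≡ count (snakeMoves true as) m
    reversed m = begin
      sumℚ (P (opposite m))                        ≡⟨ rowSum-prodAR as as≥1 (opposite m) ⟩
      count (snakeMoves false as) (opposite m)     ≡⟨ count-opposite (snakeMoves false as) m ⟨
      count (map not (snakeMoves false as)) m      ≡⟨ cong (λ w → count w m) (snakeMoves-not false as) ⟨
      count (snakeMoves true as) m                 ∎

  -- Every height can follow the virtual starting height 0 by an East step, so the
  -- chains from 0 along false ∷ w are the chains along w with a free start; their
  -- number for the snake's word is uᵀ A(k,a₁)R⋯A(k,aₙ)R u.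
  #snakeChains : ∀ as → All (1 ℕ.≤_) as → # chains Fin.zero (false ∷ snakeMoves false as) ≡ uMu (prodAR k as)
  #snakeChains as as≥1 = trans (#chains-∷ false (snakeMoves false as) Fin.zero)
                               (sym (sumℚ-cong (rowSum-prodAR as as≥1)))

sumℤ : List ℤ → ℤ
sumℤ = List.foldr ℤ._+_ (+ 0)

sumList : ∀ {A : Set} → (A → ℚ) → List A → ℚ
sumList g = List.foldr (λ x s → g x + s) 0ℚ

fromℤ-sumℤ : ∀ xs → fromℤ (sumℤ xs) ≡ sumList fromℤ xs
fromℤ-sumℤ []       = refl
fromℤ-sumℤ (x ∷ xs) = trans (fromℤ-+ x (sumℤ xs)) (cong (_+_ (fromℤ x)) (fromℤ-sumℤ xs))

fromℤ-countN : ∀ bs → fromℤ (+ countN bs) ≡ sumList indic bs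
fromℤ-countN []           = refl
fromℤ-countN (true ∷ bs)  = trans (fromℤ-+ (+ 1) (+ countN bs)) (cong (_+_ 1ℚ) (fromℤ-countN bs))
fromℤ-countN (false ∷ bs) = trans (fromℤ-countN bs) (sym (ℚP.+-identityˡ (sumList indic bs)))

prefix : ∀ {n} → ℕ → Fin n → ℚ
prefix t i = when (toℕ i ℕ.<ᵇ t) 1ℚ

sumList-take : ∀ {A : Set} {n} (g : A → ℚ) (v : Vec A n) t →
  sumList g (take t (toList v)) ≡ sumℚ (λ i → prefix t i * g (lookup v i))
sumList-take g []      zero    = refl
sumList-take g []      (suc t) = refl
sumList-take g (x ∷ v) zero    = sym (sumℚ-zero (λ i → prefix 0 i * g (lookup (x ∷ v) i)) (λ i → ℚP.*-zeroˡ (g (lookup (x ∷ v) i))))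
sumList-take g (x ∷ v) (suc t) = cong₂ _+_ (sym (ℚP.*-identityˡ (g x))) (sumList-take g v t)

average-bounds : ∀ {N} (λs c : Fin N → ℚ) lo hi → (∀ j → 0ℚ ≤ λs j) → sumℚ λs ≡ 1ℚ →
  (∀ j → lo ≤ c j) → (∀ j → c j ≤ hi) → lo ≤ sumℚ (λ j → λs j * c j) × sumℚ (λ j → λs j * c j) ≤ hi
average-bounds λs c lo hi λs≥0 Σλs≡1 lo≤c c≤hi =
  subst (_≤ sumℚ (λ j → λs j * c j)) (weighted lo) (sumℚ-mono-≤ (λ j → scale j (lo≤c j))) ,
  subst (sumℚ (λ j → λs j * c j) ≤_) (weighted hi) (sumℚ-mono-≤ (λ j → scale j (c≤hi j)))
  where
  weighted : ∀ x → sumℚ (λ j → λs j * x) ≡ x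
  weighted x = trans (sumℚ-*ʳ x λs) (trans (cong (_* x) Σλs≡1) (ℚP.*-identityˡ x))
  scale : ∀ {x y} j → x ≤ y → λs j * x ≤ λs j * y
  scale j = ℚP.*-monoˡ-≤-nonNeg (λs j) {{ℚ.nonNegative (λs≥0 j)}}

scaled-average-bounds : ∀ {N} K (λs c : Fin N → ℚ) lo hi a → (∀ j → 0ℚ ≤ λs j) → sumℚ λs ≡ 1ℚ →
  (∀ j → fromℤ lo ≤ c j) → (∀ j → c j ≤ fromℤ hi) → fromℤ a ≡ fromℤ (+ K) * sumℚ (λ j → λs j * c j) →
  + K ℤ.* lo ℤ.≤ a × a ℤ.≤ + K ℤ.* hi
scaled-average-bounds K λs c lo hi a λs≥0 Σλs≡1 lo≤c c≤hi a≡ =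
  fromℤ-cancel-≤ (subst₂ _≤_ (sym (fromℤ-* (+ K) lo)) (sym a≡) (scaleK lo≤avg)) ,
  fromℤ-cancel-≤ (subst₂ _≤_ (sym a≡) (sym (fromℤ-* (+ K) hi)) (scaleK avg≤hi))
  where
  bounds = average-bounds λs c (fromℤ lo) (fromℤ hi) λs≥0 Σλs≡1 lo≤c c≤hi
  lo≤avg = proj₁ bounds
  avg≤hi = proj₂ bounds
  scaleK : ∀ {x y} → x ≤ y → fromℤ (+ K) * x ≤ fromℤ (+ K) * y
  scaleK = ℚP.*-monoˡ-≤-nonNeg (fromℤ (+ K)) {{ℚ.nonNegative (fromℤ-mono-≤ {+ 0} {+ K} (ℤ.+≤+ z≤n))}}

pairing-average : ∀ {n N} (w x : Fin n → ℚ) K (λs : Fin N → ℚ) (b : Fin N → Fin n → ℚ) →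
  (∀ i → x i ≡ K * sumℚ (λ j → λs j * b j i)) →
  sumℚ (λ i → w i * x i) ≡ K * sumℚ (λ j → λs j * sumℚ (λ i → w i * b j i))
pairing-average w x K λs b x≡ = begin
  sumℚ (λ i → w i * x i)                                ≡⟨ sumℚ-cong pointwise ⟩
  sumℚ (λ i → K * sumℚ (λ j → λs j * (w i * b j i)))    ≡⟨ sumℚ-*ˡ K (λ i → sumℚ (λ j → λs j * (w i * b j i))) ⟩
  K * sumℚ (λ i → sumℚ (λ j → λs j * (w i * b j i)))    ≡⟨ cong (K *_) (sumℚ-swap (λ i j → λs j * (w i * b j i))) ⟩
  K * sumℚ (λ j → sumℚ (λ i → λs j * (w i * b j i)))    ≡⟨ cong (K *_) (sumℚ-cong (λ j → sumℚ-*ˡ (λs j) (λ i → w i * b j i))) ⟩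
  K * sumℚ (λ j → λs j * sumℚ (λ i → w i * b j i))      ∎
  where
  open ≡-Reasoning
  pointwise : ∀ i → w i * x i ≡ K * sumℚ (λ j → λs j * (w i * b j i))
  pointwise i = begin
    w i * x i                                        ≡⟨ cong (w i *_) (x≡ i) ⟩
    w i * (K * sumℚ (λ j → λs j * b j i))            ≡⟨ solve 3 (λ w K s → w :* (K :* s) := K :* (w :* s)) refl (w i) K _ ⟩
    K * (w i * sumℚ (λ j → λs j * b j i))            ≡⟨ cong (K *_) (sym (sumℚ-*ˡ (w i) (λ j → λs j * b j i))) ⟩
    K * sumℚ (λ j → w i * (λs j * b j i))            ≡⟨ cong (K *_) (sumℚ-cong (λ j → solve 3 (λ w l e → w :* (l :* e) := l :* (w :* e)) refl (w i) (λs j) (b j i))) ⟩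
    K * sumℚ (λ j → λs j * (w i * b j i))            ∎
    where open +-*-Solver

InBox : ℕ → ℤ → Set
InBox k x = + 0 ℤ.≤ x × x ℤ.≤ + k

PrefixBounds : (U L : List Bool) → ℕ → Vec ℤ (length U) → Set
PrefixBounds U L k z = ∀ t → + k ℤ.* + countN (take t L) ℤ.≤ sumℤ (take t (toList z))
                           × sumℤ (take t (toList z)) ℤ.≤ + k ℤ.* + countN (take t U)

intPoint-inBox : ∀ U L k z → IntPoint U L k z → ∀ i → InBox k (lookup z i)
intPoint-inBox U L k z (N , B , λs , _ , λs≥0 , Σλs≡1 , coords) i =
  subst (ℤ._≤ lookup z i) (ℤP.*-zeroʳ (+ k)) (proj₁ bounds) ,
  subst (lookup z i ℤ.≤_) (ℤP.*-identityʳ (+ k)) (proj₂ bounds)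
  where
  indic≥0 : ∀ b → 0ℚ ≤ indic b
  indic≥0 true  = fromℤ-mono-≤ {+ 0} {+ 1} (ℤ.+≤+ z≤n)
  indic≥0 false = ℚP.≤-refl
  indic≤1 : ∀ b → indic b ≤ 1ℚ
  indic≤1 true  = ℚP.≤-refl
  indic≤1 false = fromℤ-mono-≤ {+ 0} {+ 1} (ℤ.+≤+ z≤n)
  bounds = scaled-average-bounds k λs (λ j → indic (lookup (B j) i)) (+ 0) (+ 1) (lookup z i) λs≥0 Σλs≡1
             (λ j → indic≥0 (lookup (B j) i)) (λ j → indic≤1 (lookup (B j) i))
             (trans (sym (VecP.lookup-map i fromℤ z)) (coords i))

intPoint-prefixBounds : ∀ U L k z → IntPoint U L k z → PrefixBounds U L k z
intPoint-prefixBounds U L k z (N , B , λs , isBasis , λs≥0 , Σλs≡1 , coords) t =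
  scaled-average-bounds k λs c (+ countN (take t L)) (+ countN (take t U)) (sumℤ (take t (toList z))) λs≥0 Σλs≡1
    (λ j → fromℤ-mono-≤ (ℤ.+≤+ (proj₁ (proj₂ (isBasis j) t))))
    (λ j → fromℤ-mono-≤ (ℤ.+≤+ (proj₂ (proj₂ (isBasis j) t))))
    prefix-sum
  where
  open ≡-Reasoning
  c : Fin N → ℚ
  c j = fromℤ (+ countN (take t (toList (B j))))
  prefix-sum : fromℤ (sumℤ (take t (toList z))) ≡ fromℤ (+ k) * sumℚ (λ j → λs j * c j)
  prefix-sum = begin
    fromℤ (sumℤ (take t (toList z)))                        ≡⟨ fromℤ-sumℤ (take t (toList z)) ⟩
    sumList fromℤ (take t (toList z))                       ≡⟨ sumList-take fromℤ z t ⟩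
    sumℚ (λ i → prefix t i * fromℤ (lookup z i))
      ≡⟨ pairing-average (prefix t) (λ i → fromℤ (lookup z i)) (fromℤ (+ k)) λs (λ j i → indic (lookup (B j) i))
                         (λ i → trans (sym (VecP.lookup-map i fromℤ z)) (coords i)) ⟩
    fromℤ (+ k) * sumℚ (λ j → λs j * sumℚ (λ i → prefix t i * indic (lookup (B j) i)))
      ≡⟨ cong (fromℤ (+ k) *_) (sumℚ-cong (λ j → cong (λs j *_)
           (sym (trans (fromℤ-countN (take t (toList (B j)))) (sumList-take indic (B j) t))))) ⟩
    fromℤ (+ k) * sumℚ (λ j → λs j * c j)                   ∎

sum-below : ∀ n h → h ℕ.≤ n → sumℚ {n} (λ j → indic (toℕ j ℕ.<ᵇ h)) ≡ fromℤ (+ h)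
sum-below n       zero    _         = sumℚ-zero {n} (λ j → indic (toℕ j ℕ.<ᵇ 0)) (λ _ → refl)
sum-below (suc n) (suc h) (s≤s h≤n) =
  trans (cong (_+_ 1ℚ) (sum-below n h h≤n)) (sym (fromℤ-+ (+ 1) (+ h)))

bit : Bool → ℕ
bit true  = 1
bit false = 0

countN-∷ : ∀ b bs → countN (b ∷ bs) ≡ bit b ℕ.+ countN bs
countN-∷ true  bs = refl
countN-∷ false bs = refl

countN-++ : ∀ xs ys → countN (xs ++ ys) ≡ countN xs ℕ.+ countN ys
countN-++ []           ys = refl
countN-++ (true ∷ xs)  ys = cong suc (countN-++ xs ys)
countN-++ (false ∷ xs) ys = countN-++ xs ys

between-countN : ∀ U L P → length P ≡ length U → length L ≡ length U → countN L ≡ countN U →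
                 Between U L P → countN P ≡ countN U
between-countN U L P |P| |L| L≡U between = ℕP.≤-antisym
  (subst₂ ℕ._≤_ (full P |P|) (full U refl) (proj₂ (between (length U))))
  (subst₂ ℕ._≤_ (trans (full L |L|) L≡U) (full P |P|) (proj₁ (between (length U))))
  where
  full : ∀ xs → length xs ≡ length U → countN (take (length U) xs) ≡ countN xs
  full xs eq = cong countN (ListP.take-all (length U) xs (ℕP.≤-reflexive eq))

-- Whether the threshold path at some level takes a North step while the chain
-- moves by a step d from a height with "above the level" = a to one with b.
crossing : Bool → Bool → Bool → Bool
crossing false a b = b ∧ not a
crossing true  a b = b ∨ not a

-- Along an East step the height cannot drop below a level it was above, and
-- along a North step it cannot rise above a level it was below.
Monotone : Bool → Bool → Bool → Set
Monotone false a b = T a → T b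
Monotone true  a b = T b → T a

crossing-bit : ∀ d a b → Monotone d a b → bit a ℕ.+ bit (crossing d a b) ≡ bit d ℕ.+ bit b
crossing-bit false false false _ = refl
crossing-bit false false true  _ = refl
crossing-bit false true  false m = ⊥-elim (m tt)
crossing-bit false true  true  _ = refl
crossing-bit true  false false _ = refl
crossing-bit true  false true  m = ⊥-elim (m tt)
crossing-bit true  true  false _ = refl
crossing-bit true  true  true  _ = refl

crossing-indic : ∀ d a b → Monotone d a b → indic (crossing d a b) ≡ (indic d + indic b) - indic a
crossing-indic false false false _ = refl
crossing-indic false false true  _ = refl
crossing-indic false true  false m = ⊥-elim (m tt)
crossing-indic false true  true  _ = refl
crossing-indic true  false false _ = refl
crossing-indic true  false true  m = ⊥-elim (m tt)
crossing-indic true  true  false _ = refl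
crossing-indic true  true  true  _ = refl

-- A chain from p along w is closed by a final North step down to
-- the virtual height 0; its point records the height increments, North steps
-- carrying an extra k.  For the snake one starts at the virtual height 0 with the
-- word false ∷ mv, so that the step words become L and, up to the first step, U.
module ChainPoints (k : ℕ) where
  open Heights k

  kIf : Bool → ℤ
  kIf true  = + k
  kIf false = + 0

  increment : Bool → Height → Height → ℤ
  increment d p h = (kIf d ℤ.+ + toℕ h) ℤ.- + toℕ p

  point : Height → (w : List Bool) → Vec Height (length w) → Vec ℤ (length (w ++ false ∷ []))
  point p []      []       = increment true p Fin.zero ∷ []
  point p (d ∷ w) (h ∷ hs) = increment d p h ∷ point h w hs

  increment-injective : ∀ d p h h′ → increment d p h ≡ increment d p h′ → h ≡ h′
  increment-injective d p h h′ eq = FinP.toℕ-injective (ℤP.+-injective (begin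
    + toℕ h                                       ≡⟨ recover (+ toℕ h) ⟩
    ((increment d p h ℤ.+ + toℕ p) ℤ.- kIf d)     ≡⟨ cong (λ x → (x ℤ.+ + toℕ p) ℤ.- kIf d) eq ⟩
    ((increment d p h′ ℤ.+ + toℕ p) ℤ.- kIf d)    ≡⟨ recover (+ toℕ h′) ⟨
    + toℕ h′                                      ∎))
    where
    open ≡-Reasoning
    recover : ∀ x → x ≡ (((kIf d ℤ.+ x) ℤ.- + toℕ p) ℤ.+ + toℕ p) ℤ.- kIf d
    recover x = solve 3 (λ a x p → x := (((a :+ x) :- p) :+ p) :- a) refl (kIf d) x (+ toℕ p)
      where open ℤSolver.+-*-Solver

  point-injective : ∀ p w hs hs′ → point p w hs ≡ point p w hs′ → hs ≡ hs′
  point-injective p []      []       []         eq = refl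
  point-injective p (d ∷ w) (h ∷ hs) (h′ ∷ hs′) eq with increment-injective d p h h′ (VecP.∷-injectiveˡ eq)
  ... | refl = cong (h ∷_) (point-injective h w hs hs′ (VecP.∷-injectiveʳ eq))

  -- The level-j threshold path of a chain steps North exactly when the chain
  -- crosses level j (or moves North while staying above it).
  above : ℕ → Height → Bool
  above j h = j ℕ.<ᵇ toℕ h

  threshold : ℕ → Height → (w : List Bool) → Vec Height (length w) → Vec Bool (length (w ++ false ∷ []))
  threshold j p []      []       = crossing true (above j p) false ∷ []
  threshold j p (d ∷ w) (h ∷ hs) = crossing d (above j p) (above j h) ∷ threshold j h w hs

  above-monotone : ∀ j d p h → T (step d p h) → Monotone d (above j p) (above j h)
  above-monotone j false p h p≤h j<p = ℕP.<⇒<ᵇ (ℕP.<-≤-trans (ℕP.<ᵇ⇒< j (toℕ p) j<p) (ℕP.≤ᵇ⇒≤ (toℕ p) (toℕ h) p≤h))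
  above-monotone j true  p h h≤p j<h = ℕP.<⇒<ᵇ (ℕP.<-≤-trans (ℕP.<ᵇ⇒< j (toℕ h) j<h) (ℕP.≤ᵇ⇒≤ (toℕ h) (toℕ p) h≤p))

  ThresholdSandwich : ℕ → Height → (w : List Bool) → Vec Height (length w) → Set
  ThresholdSandwich j p w hs = ∀ t →
    countN (take t (w ++ true ∷ [])) ℕ.≤ bit (above j p) ℕ.+ countN (take t (toList (threshold j p w hs)))
    × bit (above j p) ℕ.+ countN (take t (toList (threshold j p w hs))) ℕ.≤ suc (countN (take t (w ++ false ∷ [])))

  bit≤1 : ∀ b → bit b ℕ.≤ 1
  bit≤1 true  = s≤s z≤n
  bit≤1 false = z≤n

  threshold-sandwich : ∀ j p w hs → IsChain p w hs → ThresholdSandwich j p w hs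
  threshold-sandwich j p w       hs       _          zero    =
    z≤n , ℕP.≤-trans (ℕP.≤-reflexive (ℕP.+-identityʳ _)) (bit≤1 (above j p))
  threshold-sandwich j p []      []       _          (suc t) = ℕP.≤-reflexive (sym closing) , ℕP.≤-reflexive closing
    where
    a = above j p
    closing : bit a ℕ.+ countN (crossing true a false ∷ take t []) ≡ suc (countN (false ∷ take t []))
    closing rewrite ListP.take-[] {A = Bool} t =
      trans (cong (bit a ℕ.+_) (trans (countN-∷ (crossing true a false) []) (ℕP.+-identityʳ _)))
            (crossing-bit true a false (λ ()))
  threshold-sandwich j p (d ∷ w) (h ∷ hs) (p~h , chn) (suc t) =
    subst₂ ℕ._≤_ (sym (countN-∷ d _)) (sym shift) (ℕP.+-monoʳ-≤ (bit d) (proj₁ rest)) ,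
    subst₂ ℕ._≤_ (sym shift) (trans (ℕP.+-suc (bit d) _) (cong suc (sym (countN-∷ d _)))) (ℕP.+-monoʳ-≤ (bit d) (proj₂ rest))
    where
    a = above j p
    b = above j h
    P = take t (toList (threshold j h w hs))
    rest = threshold-sandwich j h w hs chn t
    shift : bit a ℕ.+ countN (crossing d a b ∷ P) ≡ bit d ℕ.+ (bit b ℕ.+ countN P)
    shift = begin
      bit a ℕ.+ countN (crossing d a b ∷ P)           ≡⟨ cong (bit a ℕ.+_) (countN-∷ (crossing d a b) P) ⟩
      bit a ℕ.+ (bit (crossing d a b) ℕ.+ countN P)   ≡⟨ ℕP.+-assoc (bit a) _ (countN P) ⟨
      (bit a ℕ.+ bit (crossing d a b)) ℕ.+ countN P   ≡⟨ cong (ℕ._+ countN P) (crossing-bit d a b (above-monotone j d p h p~h)) ⟩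
      (bit d ℕ.+ bit b) ℕ.+ countN P                  ≡⟨ ℕP.+-assoc (bit d) (bit b) (countN P) ⟩
      bit d ℕ.+ (bit b ℕ.+ countN P)                  ∎
      where open ≡-Reasoning

  threshold-isBasis : ∀ j mv H → IsChain Fin.zero (false ∷ mv) H →
    IsBasisPath (true ∷ mv ++ false ∷ []) (false ∷ mv ++ true ∷ []) (threshold j Fin.zero (false ∷ mv) H)
  threshold-isBasis j mv H chn = between-countN U L P (VecP.length-toList (threshold j Fin.zero (false ∷ mv) H))
                                   same-length same-countN between , between
    where
    U = true ∷ mv ++ false ∷ []
    L = false ∷ mv ++ true ∷ []
    P = toList (threshold j Fin.zero (false ∷ mv) H)
    between : Between U L P
    between zero    = z≤n , z≤n
    between (suc t) = threshold-sandwich j Fin.zero (false ∷ mv) H chn (suc t)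
    same-length : length L ≡ length U
    same-length = cong suc (trans (ListP.length-++ mv) (sym (ListP.length-++ mv)))
    same-countN : countN L ≡ countN U
    same-countN = trans (countN-++ mv (true ∷ []))
                        (trans (ℕP.+-comm (countN mv) 1) (cong suc (sym (trans (countN-++ mv (false ∷ [])) (ℕP.+-identityʳ _)))))

  kIf-indic : ∀ d → fromℤ (+ k) * indic d ≡ fromℤ (kIf d)
  kIf-indic true  = ℚP.*-identityʳ (fromℤ (+ k))
  kIf-indic false = ℚP.*-zeroʳ (fromℤ (+ k))

  increment-sum : ∀ d p h → T (step d p h) →
    sumℚ {k} (λ j → indic (crossing d (above (toℕ j) p) (above (toℕ j) h))) ≡ fromℤ (increment d p h)
  increment-sum d p h p~h = begin
    sumℚ {k} (λ j → indic (crossing d (a j) (b j)))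
      ≡⟨ sumℚ-cong (λ j → crossing-indic d (a j) (b j) (above-monotone (toℕ j) d p h p~h)) ⟩
    sumℚ {k} (λ j → (indic d + indic (b j)) - indic (a j))
      ≡⟨ sumℚ-- (λ j → indic d + indic (b j)) (λ j → indic (a j)) ⟩
    sumℚ {k} (λ j → indic d + indic (b j)) - sumℚ {k} (λ j → indic (a j))
      ≡⟨ cong (_- sumℚ {k} (λ j → indic (a j))) (sumℚ-+ (λ _ → indic d) (λ j → indic (b j))) ⟩
    (sumℚ {k} (λ _ → indic d) + sumℚ {k} (λ j → indic (b j))) - sumℚ {k} (λ j → indic (a j))
      ≡⟨ cong₂ _-_ (cong₂ _+_ (trans (sumℚ-const k (indic d)) (kIf-indic d)) (sum-below k (toℕ h) (toℕ≤k h)))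
                   (sum-below k (toℕ p) (toℕ≤k p)) ⟩
    (fromℤ (kIf d) + fromℤ (+ toℕ h)) - fromℤ (+ toℕ p)
      ≡⟨ trans (cong (_- fromℤ (+ toℕ p)) (sym (fromℤ-+ (kIf d) (+ toℕ h)))) (sym (fromℤ-- (kIf d ℤ.+ + toℕ h) (+ toℕ p))) ⟩
    fromℤ (increment d p h) ∎
    where
    open ≡-Reasoning
    a = λ (j : Fin k) → above (toℕ j) p
    b = λ (j : Fin k) → above (toℕ j) h

  threshold-sum : ∀ p w hs → IsChain p w hs → ∀ i →
    sumℚ {k} (λ j → indic (lookup (threshold (toℕ j) p w hs) i)) ≡ fromℤ (lookup (point p w hs) i)
  threshold-sum p []      []       _          Fin.zero    = increment-sum true p Fin.zero tt
  threshold-sum p (d ∷ w) (h ∷ hs) (p~h , _)  Fin.zero    = increment-sum d p h p~h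
  threshold-sum p (d ∷ w) (h ∷ hs) (_ , chn)  (Fin.suc i) = threshold-sum h w hs chn i

  -- Hence, weighting each threshold path by λ₀ = 1/k, the point of a chain lies in k·P.
  chain-isIntPoint : ∀ mv H (λ₀ : ℚ) → fromℤ (+ k) * λ₀ ≡ 1ℚ → 0ℚ ≤ λ₀ → IsChain Fin.zero (false ∷ mv) H →
    IntPoint (true ∷ mv ++ false ∷ []) (false ∷ mv ++ true ∷ []) k (point Fin.zero (false ∷ mv) H)
  chain-isIntPoint mv H λ₀ kλ₀≡1 λ₀≥0 chn =
    k , B , (λ _ → λ₀) , (λ j → threshold-isBasis (toℕ j) mv H chn) , (λ _ → λ₀≥0) ,
    trans (sumℚ-const k λ₀) kλ₀≡1 , coordinate
    where
    open ≡-Reasoning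
    z = point Fin.zero (false ∷ mv) H
    B = λ (j : Fin k) → threshold (toℕ j) Fin.zero (false ∷ mv) H
    coordinate : ∀ i → lookup (Vec.map fromℤ z) i ≡ fromℤ (+ k) * sumℚ (λ j → λ₀ * indic (lookup (B j) i))
    coordinate i = begin
      lookup (Vec.map fromℤ z) i                     ≡⟨ VecP.lookup-map i fromℤ z ⟩
      fromℤ (lookup z i)                             ≡⟨ threshold-sum Fin.zero (false ∷ mv) H chn i ⟨
      S                                              ≡⟨ ℚP.*-identityˡ S ⟨
      1ℚ * S                                         ≡⟨ cong (_* S) kλ₀≡1 ⟨
      (fromℤ (+ k) * λ₀) * S                         ≡⟨ ℚP.*-assoc (fromℤ (+ k)) λ₀ S ⟩
      fromℤ (+ k) * (λ₀ * S)                         ≡⟨ cong (fromℤ (+ k) *_) (sumℚ-*ˡ λ₀ (λ j → indic (lookup (B j) i))) ⟨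
      fromℤ (+ k) * sumℚ (λ j → λ₀ * indic (lookup (B j) i)) ∎
      where S = sumℚ {k} (λ j → indic (lookup (B j) i))

-- Conversely, every integer point of k·P for the snake is the point of a chain:
-- the heights are recovered from the partial sums of its coordinates.
module PointChains (k : ℕ) where
  open Heights k
  open ChainPoints k

  Bounded : ℤ → (w : List Bool) → Vec ℤ (length (w ++ false ∷ [])) → Set
  Bounded c w xs = ∀ t → + k ℤ.* + countN (take t (w ++ true ∷ [])) ℤ.≤ c ℤ.+ sumℤ (take t (toList xs))
                       × c ℤ.+ sumℤ (take t (toList xs)) ℤ.≤ + k ℤ.+ + k ℤ.* + countN (take t (w ++ false ∷ []))

  k*countN-∷ : ∀ d bs → + k ℤ.* + countN (d ∷ bs) ≡ kIf d ℤ.+ + k ℤ.* + countN bs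
  k*countN-∷ d bs = trans (cong (λ n → + k ℤ.* + n) (countN-∷ d bs))
                          (trans (ℤP.*-distribˡ-+ (+ k) (+ bit d) (+ countN bs)) (cong (ℤ._+ (+ k ℤ.* + countN bs)) (k*bit d)))
    where
    k*bit : ∀ d → + k ℤ.* + bit d ≡ kIf d
    k*bit true  = ℤP.*-identityʳ (+ k)
    k*bit false = ℤP.*-zeroʳ (+ k)

  bounded-start : ∀ c w xs → Bounded c w xs → InBox k c
  bounded-start c w xs bnd =
    subst₂ ℤ._≤_ (ℤP.*-zeroʳ (+ k)) (ℤP.+-identityʳ c) (proj₁ (bnd 0)) ,
    subst₂ ℤ._≤_ (ℤP.+-identityʳ c) (trans (cong (ℤ._+_ (+ k)) (ℤP.*-zeroʳ (+ k))) (ℤP.+-identityʳ (+ k))) (proj₂ (bnd 0))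

  bounded-∷ : ∀ c d w x xs → Bounded c (d ∷ w) (x ∷ xs) → Bounded ((c ℤ.+ x) ℤ.- kIf d) w xs
  bounded-∷ c d w x xs bnd t =
    subst₂ ℤ._≤_ (cancel (+ k ℤ.* + countN (take t (w ++ true ∷ []))))
                 (regroup (sumℤ (take t (toList xs))))
                 (ℤP.+-monoˡ-≤ (ℤ.- kIf d) (subst (ℤ._≤ c ℤ.+ (x ℤ.+ sumℤ (take t (toList xs)))) (k*countN-∷ d _) (proj₁ (bnd (suc t))))) ,
    subst₂ ℤ._≤_ (regroup (sumℤ (take t (toList xs))))
                 (cancel′ (+ k ℤ.* + countN (take t (w ++ false ∷ []))))
                 (ℤP.+-monoˡ-≤ (ℤ.- kIf d) (subst (c ℤ.+ (x ℤ.+ sumℤ (take t (toList xs))) ℤ.≤_) (cong (ℤ._+_ (+ k)) (k*countN-∷ d _)) (proj₂ (bnd (suc t)))))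
    where
    open ℤSolver.+-*-Solver
    D = kIf d
    cancel : ∀ n → (D ℤ.+ n) ℤ.- D ≡ n
    cancel n = solve 2 (λ D n → (D :+ n) :- D := n) refl D n
    cancel′ : ∀ n → (+ k ℤ.+ (D ℤ.+ n)) ℤ.- D ≡ + k ℤ.+ n
    cancel′ n = solve 3 (λ K D n → (K :+ (D :+ n)) :- D := K :+ n) refl (+ k) D n
    regroup : ∀ S → (c ℤ.+ (x ℤ.+ S)) ℤ.- D ≡ ((c ℤ.+ x) ℤ.- D) ℤ.+ S
    regroup S = solve 4 (λ c x S D → (c :+ (x :+ S)) :- D := ((c :+ x) :- D) :+ S) refl c x S D

  toHeight : ∀ c → InBox k c → Σ Height (λ h → + toℕ h ≡ c)
  toHeight (+ n) (_ , ℤ.+≤+ n≤k) = fromℕ< (s≤s n≤k) , cong +_ (FinP.toℕ-fromℕ< (s≤s n≤k))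

  increment-step : ∀ d p h x → InBox k x → + toℕ h ≡ (+ toℕ p ℤ.+ x) ℤ.- kIf d → T (step d p h)
  increment-step false p h x (0≤x , _) h≡ = ℕP.≤⇒≤ᵇ (ℤP.drop‿+≤+ (subst (+ toℕ p ℤ.≤_) (sym h≡)
    (subst₂ ℤ._≤_ (ℤP.+-identityʳ (+ toℕ p)) (sym (ℤP.+-identityʳ (+ toℕ p ℤ.+ x))) (ℤP.+-monoʳ-≤ (+ toℕ p) 0≤x))))
  increment-step true  p h x (_ , x≤k) h≡ = ℕP.≤⇒≤ᵇ (ℤP.drop‿+≤+ (subst (ℤ._≤ + toℕ p) (sym h≡)
    (subst (((+ toℕ p ℤ.+ x) ℤ.- + k) ℤ.≤_) (solve 2 (λ P K → (P :+ K) :- K := P) refl (+ toℕ p) (+ k))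
      (ℤP.+-monoˡ-≤ (ℤ.- + k) (ℤP.+-monoʳ-≤ (+ toℕ p) x≤k)))))
    where open ℤSolver.+-*-Solver

  increment-≡ : ∀ d p h x → + toℕ h ≡ (+ toℕ p ℤ.+ x) ℤ.- kIf d → x ≡ increment d p h
  increment-≡ d p h x h≡ = trans (solve 3 (λ D P x → x := (D :+ ((P :+ x) :- D)) :- P) refl (kIf d) (+ toℕ p) x)
                                 (cong (λ y → (kIf d ℤ.+ y) ℤ.- + toℕ p) (sym h≡))
    where open ℤSolver.+-*-Solver

  chain-of-bounded : ∀ p w xs → Bounded (+ toℕ p) w xs → (∀ i → InBox k (lookup xs i)) →
                     Σ (Vec Height (length w)) (λ hs → IsChain p w hs × xs ≡ point p w hs)
  chain-of-bounded p [] (x ∷ []) bnd _ = [] , tt , cong (_∷ []) (increment-≡ true p Fin.zero x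
    (sym (trans (cong (ℤ._- + k) (ℤP.≤-antisym P+x≤k k≤P+x)) (ℤP.+-inverseʳ (+ k)))))
    where
    P+x = + toℕ p ℤ.+ x
    k≤P+x : + k ℤ.≤ P+x
    k≤P+x = subst₂ ℤ._≤_ (ℤP.*-identityʳ (+ k)) (cong (ℤ._+_ (+ toℕ p)) (ℤP.+-identityʳ x)) (proj₁ (bnd 1))
    P+x≤k : P+x ℤ.≤ + k
    P+x≤k = subst₂ ℤ._≤_ (cong (ℤ._+_ (+ toℕ p)) (ℤP.+-identityʳ x))
                         (trans (cong (ℤ._+_ (+ k)) (ℤP.*-zeroʳ (+ k))) (ℤP.+-identityʳ (+ k))) (proj₂ (bnd 1))
  chain-of-bounded p (d ∷ w) (x ∷ xs) bnd box
    with toHeight ((+ toℕ p ℤ.+ x) ℤ.- kIf d) (bounded-start _ w xs (bounded-∷ (+ toℕ p) d w x xs bnd))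
  ... | h , h≡ with chain-of-bounded h w xs (subst (λ c → Bounded c w xs) (sym h≡) (bounded-∷ (+ toℕ p) d w x xs bnd))
                                             (λ i → box (Fin.suc i))
  ...   | hs , chn , xs≡ = h ∷ hs , (increment-step d p h x (box Fin.zero) h≡ , chn) ,
                           cong₂ _∷_ (increment-≡ d p h x h≡) xs≡

module SnakePoints (k′ : ℕ) where
  k : ℕ
  k = suc k′
  open Heights k
  open ChainPoints k
  open PointChains k

  module _ (mv : List Bool) where
    U L : List Bool
    U = true ∷ mv ++ false ∷ []
    L = false ∷ mv ++ true ∷ []

    points : List (Vec ℤ (length U))
    points = map (point Fin.zero (false ∷ mv)) (chains Fin.zero (false ∷ mv))

    points-unique : Unique points
    points-unique = Unique.map⁺ (point-injective Fin.zero (false ∷ mv) _ _) (chains-unique Fin.zero (false ∷ mv))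

    prefixBounds⇒bounded : ∀ z → PrefixBounds U L k z → Bounded (+ 0) (false ∷ mv) z
    prefixBounds⇒bounded z _ zero =
      subst (ℤ._≤ + 0) (sym (ℤP.*-zeroʳ (+ k))) ℤP.≤-refl ,
      subst (+ 0 ℤ.≤_) (sym (trans (cong (ℤ._+_ (+ k)) (ℤP.*-zeroʳ (+ k))) (ℤP.+-identityʳ (+ k)))) (ℤ.+≤+ z≤n)
    prefixBounds⇒bounded z bounds (suc t) =
      subst (_ ℤ.≤_) (sym (ℤP.+-identityˡ S)) (proj₁ (bounds (suc t))) ,
      subst₂ ℤ._≤_ (sym (ℤP.+-identityˡ S)) (k*countN-∷ true (take t (mv ++ false ∷ []))) (proj₂ (bounds (suc t)))
      where S = sumℤ (take (suc t) (toList z))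

    points-complete : ∀ z → IntPoint U L k z → z ∈ points
    points-complete z z∈kP = point-in-points (chain-of-bounded Fin.zero (false ∷ mv) z
      (prefixBounds⇒bounded z (intPoint-prefixBounds U L k z z∈kP)) (intPoint-inBox U L k z z∈kP))
      where
      point-in-points : Σ (Vec Height (length (false ∷ mv))) (λ H → IsChain Fin.zero (false ∷ mv) H × z ≡ point Fin.zero (false ∷ mv) H) →
                        z ∈ points
      point-in-points (H , chn , z≡) =
        subst (_∈ points) (sym z≡) (∈-map⁺ (point Fin.zero (false ∷ mv)) (chains-complete Fin.zero (false ∷ mv) H chn))

    points-sound : ∀ z → z ∈ points → IntPoint U L k z
    points-sound z z∈ = chain-point (∈-map⁻ (point Fin.zero (false ∷ mv)) z∈)
      where
      chain-point : Σ (Vec Height (length (false ∷ mv))) (λ H → H ∈ chains Fin.zero (false ∷ mv) × z ≡ point Fin.zero (false ∷ mv) H) →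
                    IntPoint U L k z
      chain-point (H , H∈ , z≡) = subst (IntPoint U L k) (sym z≡)
        (chain-isIntPoint mv H (recip k′) (trans (ℚP.*-comm (fromℤ (+ k)) (recip k′)) (recip-inverse k′))
                          (ℚ.*≤* (ℤ.+≤+ z≤n)) (chains-sound Fin.zero (false ∷ mv) H H∈))

  #points : ∀ as → All (1 ℕ.≤_) as → # points (snakeMoves false as) ≡ uMu (prodAR k as)
  #points as as≥1 = trans (#-map _ (chains Fin.zero (false ∷ snakeMoves false as))) (#snakeChains as as≥1)

-- Theorem 3.10: the points of the chains are exactly the integer points of
-- k·P_{S(a₁,…,aₙ)}, without repetition, and there are uᵀ A(k,a₁)R⋯A(k,aₙ)R u of them.
-- (The count only needs every aᵢ ≥ 1.)
theorem3p10 : (k a₁ : ℕ) (as : List ℕ) → 1 ℕ.≤ k → 1 ℕ.≤ a₁ → All (2 ℕ.≤_) as →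
    Σ (List (Vec ℤ (length (snakeU (a₁ ∷ as))))) λ pts →
      Unique pts
      × (∀ z → (z ∈ pts) ⇔ IntPoint (snakeU (a₁ ∷ as)) (snakeL (a₁ ∷ as)) k z)
      × ((+ length pts / 1) ≡ uMu (prodAR k (a₁ ∷ as)))
theorem3p10 (suc k′) a₁ as (s≤s z≤n) a₁≥1 as≥2 =
  points mv , points-unique mv ,
  (λ z → mk⇔ (points-sound mv z) (points-complete mv z)) ,
  #points (a₁ ∷ as) (a₁≥1 All.∷ All.map (ℕP.≤-trans (s≤s z≤n)) as≥2)
  where
  open SnakePoints k′
  mv = snakeMoves false (a₁ ∷ as)
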